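{- Let $V=\{1,\dots,n\}$, let $f:2^V\to\mathbb{R}$ be submodular with $f(\emptyset)=0$, and let $A\subseteq V$. Define $\partial^f_{i,1}(A)=\{x\in\mathbb{R}^n: x(j)\le f(j\mid A\setminus\{j\})\ \forall j\in A,\ x(j)\ge f(\{j\})\ \forall j\notin A\}$, $\partial^f_{i,2}(A)=\{x\in\mathbb{R}^n: x(j)\le f(j\mid V\setminus\{j\})\ \forall j\in A,\ x(j)\ge f(j\mid A)\ \forall j\notin A\}$, and $\partial^f_{i,(1,2)}(A)=\{\lambda x_1+(1-\lambda)x_2: \lambda\in[0,1],\ x_1\in\partial^f_{i,1}(A),\ x_2\in\partial^f_{i,2}(A)\}$. If $\mathbf{0}\in\partial^f_{i,(1,2)}(A)$, then $A$ is a global maximizer of $f$, i.e. $f(A)\ge f(X)$ for all $X\subseteq V$.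
   Context: A set function $f:2^V\to\mathbb{R}$ is submodular if $f(S)+f(T)\ge f(S\cup T)+f(S\cap T)$ for all $S,T\subseteq V$. For $j\in V$ and $S\subseteq V$, $f(j\mid S)=f(S\cup\{j\})-f(S)$. -}

module Defs where

open import Level using (Level; _⊔_; suc)
open import Data.Nat using (ℕ)
open import Data.Fin using (Fin)
open import Data.Fin.Subset using (Subset; _∪_; _∩_; ⁅_⁆; _∈_; _∉_; ⊤; ⊥) renaming (_-_ to _∖_)
open import Data.Product using (Σ; _×_)
open import Algebra.Bundles using (CommutativeRing)
open import Relation.Binary.Structures using (IsTotalOrder)

-- A (totally) ordered commutative ring, with the standard axioms:
-- ≤ is a total order (w.r.t. the ring's equality ≈), compatible with +,
-- and the product of nonnegative elements is nonnegative.
-- ℝ is an instance; the statement is made for every such ring.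
record OrderedCommutativeRing (c ℓ₁ ℓ₂ : Level) : Set (suc (c ⊔ ℓ₁ ⊔ ℓ₂)) where
  field
    commutativeRing : CommutativeRing c ℓ₁
  open CommutativeRing commutativeRing public
  infix 4 _≤_
  field
    _≤_           : Carrier → Carrier → Set ℓ₂
    isTotalOrder  : IsTotalOrder _≈_ _≤_
    +-monoˡ-≤     : ∀ {x y} z → x ≤ y → x + z ≤ y + z
    *-nonneg      : ∀ {x y} → 0# ≤ x → 0# ≤ y → 0# ≤ x * y

module _ {c ℓ₁ ℓ₂ : Level} (R : OrderedCommutativeRing c ℓ₁ ℓ₂) {n : ℕ} where
  open OrderedCommutativeRing R

  Submodular : (Subset n → Carrier) → Set ℓ₂
  Submodular f = ∀ S T → f (S ∪ T) + f (S ∩ T) ≤ f S + f T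

  marginal : (Subset n → Carrier) → Fin n → Subset n → Carrier
  marginal f j S = f (S ∪ ⁅ j ⁆) - f S

  ∂₁ : (Subset n → Carrier) → Subset n → (Fin n → Carrier) → Set ℓ₂
  ∂₁ f A x = (∀ j → j ∈ A → x j ≤ marginal f j (A ∖ j))
           × (∀ j → j ∉ A → f ⁅ j ⁆ ≤ x j)

  ∂₂ : (Subset n → Carrier) → Subset n → (Fin n → Carrier) → Set ℓ₂
  ∂₂ f A x = (∀ j → j ∈ A → x j ≤ marginal f j (⊤ ∖ j))
           × (∀ j → j ∉ A → marginal f j A ≤ x j)

  ∂₁₂ : (Subset n → Carrier) → Subset n → (Fin n → Carrier) → Set (c ⊔ ℓ₁ ⊔ ℓ₂)
  ∂₁₂ f A x = Σ Carrier λ t → Σ (Fin n → Carrier) λ x₁ → Σ (Fin n → Carrier) λ x₂ →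
    (0# ≤ t) × (t ≤ 1#) × ∂₁ f A x₁ × ∂₂ f A x₂ ×
    (∀ j → x j ≈ t * x₁ j + (1# - t) * x₂ j)

{-# OPTIONS --safe #-}
module Submission where

-- x lies in the superdifferential of f at A when A maximises f − x(·), where
-- x(S) = Σ_{j ∈ S} x(j).  This set is convex, and 0 lies in it exactly when A
-- maximises f, so it suffices that ∂_{i,1}(A) and ∂_{i,2}(A) lie in it.  For x in
-- either set, grow chains one element at a time (from A ∩ X up to X and to A,
-- resp. from A up to A ∪ X and from X up to X ∪ A): by diminishing returns each
-- marginal gain is bounded by x at the added element, so f − x(·) is monotone
-- along each chain, and the chains link X to A.

open import Defs
open import Level using (Level)
open import Data.Nat using (ℕ)
open import Data.Fin using (Fin; zero; suc)
open import Data.Fin.Subset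
  using (Subset; inside; outside; ⊥; ⊤; ⁅_⁆; _∪_; _∩_; _∈_; _∉_; _⊆_)
  renaming (_-_ to _∖_)
open import Data.Fin.Subset.Properties
  using ( drop-there; s⊆s; out⊆; ⊆-refl; ⊆-trans; ⊆-reflexive; ⊆-antisym; ⊥⊆; ⊆⊤
        ; x∈⁅y⁆⇒x≡y; p⊆p∪q; q⊆p∪q; x∈p∪q⁻; p∩q⊆p; p∩q⊆q; x∈p∩q⁺; x∈p∩q⁻
        ; x∈p∧x≢y⇒x∈p-y; ∪-assoc; ∪-comm; ∪-identityˡ; ∪-identityʳ )
open import Data.Vec.Base using ([]; _∷_; here; there)
open import Data.Product using (_,_)
open import Data.Sum using (inj₁; inj₂; [_,_]′)
open import Function using (_∘_; flip; id)
open import Relation.Binary.Core using (Rel)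
open import Relation.Binary.Definitions using (Reflexive; Transitive)
open import Relation.Binary.Bundles using (Poset)
open import Relation.Binary.Structures using (IsTotalOrder)
open import Relation.Binary.PropositionalEquality as ≡ using (_≡_; cong)
open import Relation.Nullary using (contradiction)
open import Algebra.Bundles using (CommutativeSemiring)
import Algebra.Properties.CommutativeSemigroup as CommutativeSemigroupProperties
import Algebra.Properties.Ring as RingProperties
import Relation.Binary.Reasoning.PartialOrder as PosetReasoning
import Relation.Binary.Reasoning.Setoid as SetoidReasoning

x∉p∖x : ∀ {n} (p : Subset n) x → x ∉ p ∖ x
x∉p∖x (s ∷ p) zero    ()
x∉p∖x (s ∷ p) (suc x) = x∉p∖x p x ∘ drop-there

module _ {n : ℕ} where

  p⊆q∧x∉p⇒p⊆q∖x : ∀ {p q : Subset n} {x} → p ⊆ q → x ∉ p → p ⊆ q ∖ x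
  p⊆q∧x∉p⇒p⊆q∖x p⊆q x∉p y∈p = x∈p∧x≢y⇒x∈p-y (p⊆q y∈p) λ { ≡.refl → x∉p y∈p }

  p⊆q⇒p∪q≡q : ∀ {p q : Subset n} → p ⊆ q → p ∪ q ≡ q
  p⊆q⇒p∪q≡q {p} {q} p⊆q =
    ⊆-antisym (λ y∈p∪q → [ p⊆q , id ]′ (x∈p∪q⁻ p q y∈p∪q)) (q⊆p∪q p q)

  p⊆q⇒[p∪⁅x⁆]∪q≡q∪⁅x⁆ : ∀ {p q : Subset n} x → p ⊆ q → (p ∪ ⁅ x ⁆) ∪ q ≡ q ∪ ⁅ x ⁆
  p⊆q⇒[p∪⁅x⁆]∪q≡q∪⁅x⁆ {p} {q} x p⊆q = begin
    (p ∪ ⁅ x ⁆) ∪ q  ≡⟨ cong (_∪ q) (∪-comm p ⁅ x ⁆) ⟩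
    (⁅ x ⁆ ∪ p) ∪ q  ≡⟨ ∪-assoc ⁅ x ⁆ p q ⟩
    ⁅ x ⁆ ∪ (p ∪ q)  ≡⟨ cong (⁅ x ⁆ ∪_) (p⊆q⇒p∪q≡q p⊆q) ⟩
    ⁅ x ⁆ ∪ q        ≡⟨ ∪-comm ⁅ x ⁆ q ⟩
    q ∪ ⁅ x ⁆        ∎
    where open ≡.≡-Reasoning

  p⊆q∧x∉q⇒[p∪⁅x⁆]∩q≡p : ∀ {p q : Subset n} {x} → p ⊆ q → x ∉ q → (p ∪ ⁅ x ⁆) ∩ q ≡ p
  p⊆q∧x∉q⇒[p∪⁅x⁆]∩q≡p {p} {q} {x} p⊆q x∉q = ⊆-antisym ⊆p p⊆
    where
    ⊆p : (p ∪ ⁅ x ⁆) ∩ q ⊆ p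
    ⊆p y∈ with x∈p∩q⁻ (p ∪ ⁅ x ⁆) q y∈
    ... | y∈p∪⁅x⁆ , y∈q with x∈p∪q⁻ p ⁅ x ⁆ y∈p∪⁅x⁆
    ...   | inj₁ y∈p    = y∈p
    ...   | inj₂ y∈⁅x⁆ with x∈⁅y⁆⇒x≡y x y∈⁅x⁆
    ...     | ≡.refl = contradiction y∈q x∉q
    p⊆ : p ⊆ (p ∪ ⁅ x ⁆) ∩ q
    p⊆ y∈p = x∈p∩q⁺ (p⊆p∪q ⁅ x ⁆ y∈p , p⊆q y∈p)

module _ {a ℓ} {T : Set a} (_∼_ : Rel T ℓ) where

  Stepwise : ∀ {n} → (Subset n → T) → Subset n → Subset n → Set ℓ
  Stepwise h S D =
    ∀ {Z k} → k ∈ D → k ∉ Z → S ⊆ Z → Z ⊆ S ∪ D → h (Z ∪ ⁅ k ⁆) ∼ h Z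

  module _ (∼-refl : Reflexive _∼_) (∼-trans : Transitive _∼_) where

    telescope : ∀ {n} (h : Subset n → T) S D → Stepwise h S D → h (S ∪ D) ∼ h S
    telescope h []           []           step = ∼-refl
    telescope h (inside ∷ S) (d ∷ D)      step =
      telescope (h ∘ (inside ∷_)) S D λ k∈D k∉Z S⊆Z Z⊆S∪D →
        step (there k∈D) (k∉Z ∘ drop-there) (s⊆s S⊆Z) (s⊆s Z⊆S∪D)
    telescope h (outside ∷ S) (d ∷ D)     step =
      ∼-trans (head-step d step)
        (telescope (h ∘ (outside ∷_)) S D λ k∈D k∉Z S⊆Z Z⊆S∪D →
          step (there k∈D) (k∉Z ∘ drop-there) (s⊆s S⊆Z) (out⊆ Z⊆S∪D))
      where
      head-step : ∀ d → Stepwise h (outside ∷ S) (d ∷ D) →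
                  h (d ∷ (S ∪ D)) ∼ h (outside ∷ (S ∪ D))
      head-step outside _    = ∼-refl
      head-step inside  step =
        ≡.subst (λ U → h (inside ∷ U) ∼ h (outside ∷ (S ∪ D))) (∪-identityʳ (S ∪ D))
          (step here (λ ()) (s⊆s (p⊆p∪q D)) (out⊆ ⊆-refl))

module Modular {c ℓ} (R : CommutativeSemiring c ℓ) where
  open CommutativeSemiring R hiding (zero)
  open CommutativeSemigroupProperties +-commutativeSemigroup using (interchange)
  open SetoidReasoning setoid

  modular : ∀ {n} → (Fin n → Carrier) → Subset n → Carrier
  modular x []            = 0#
  modular x (inside ∷ S)  = x zero + modular (x ∘ suc) S
  modular x (outside ∷ S) = modular (x ∘ suc) S

  modular-∪⁅⁆ : ∀ {n} (x : Fin n → Carrier) {Z k} → k ∉ Z →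
                modular x (Z ∪ ⁅ k ⁆) ≈ modular x Z + x k
  modular-∪⁅⁆ x {inside ∷ Z}  {zero}  k∉Z = contradiction here k∉Z
  modular-∪⁅⁆ x {outside ∷ Z} {zero}  _
    rewrite ∪-identityʳ Z = +-comm (x zero) (modular (x ∘ suc) Z)
  modular-∪⁅⁆ x {inside ∷ Z}  {suc k} k∉Z = begin
    x zero + modular (x ∘ suc) (Z ∪ ⁅ k ⁆)    ≈⟨ +-congˡ (modular-∪⁅⁆ (x ∘ suc) (k∉Z ∘ there)) ⟩
    x zero + (modular (x ∘ suc) Z + x (suc k)) ≈⟨ +-assoc _ _ _ ⟨
    x zero + modular (x ∘ suc) Z + x (suc k)   ∎
  modular-∪⁅⁆ x {outside ∷ Z} {suc k} k∉Z = modular-∪⁅⁆ (x ∘ suc) (k∉Z ∘ there)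

  modular-cong : ∀ {n} {x y : Fin n → Carrier} → (∀ j → x j ≈ y j) →
                 ∀ S → modular x S ≈ modular y S
  modular-cong x≈y []            = refl
  modular-cong x≈y (inside ∷ S)  = +-cong (x≈y zero) (modular-cong (x≈y ∘ suc) S)
  modular-cong x≈y (outside ∷ S) = modular-cong (x≈y ∘ suc) S

  modular-linear : ∀ {n} t s (x y : Fin n → Carrier) S →
    modular (λ j → t * x j + s * y j) S ≈ t * modular x S + s * modular y S
  modular-linear t s x y []            = sym (trans (+-cong (zeroʳ t) (zeroʳ s)) (+-identityʳ 0#))
  modular-linear t s x y (outside ∷ S) = modular-linear t s (x ∘ suc) (y ∘ suc) S
  modular-linear t s x y (inside ∷ S)  = begin
    (t * x zero + s * y zero) + modular (λ j → t * x (suc j) + s * y (suc j)) S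
      ≈⟨ +-congˡ (modular-linear t s (x ∘ suc) (y ∘ suc) S) ⟩
    (t * x zero + s * y zero) + (t * X + s * Y)  ≈⟨ interchange _ _ _ _ ⟩
    (t * x zero + t * X) + (s * y zero + s * Y)  ≈⟨ +-cong (distribˡ t _ _) (distribˡ s _ _) ⟨
    t * (x zero + X) + s * (y zero + Y)          ∎
    where
    X = modular (x ∘ suc) S
    Y = modular (y ∘ suc) S

  modular-zero : ∀ {n} (S : Subset n) → modular (λ _ → 0#) S ≈ 0#
  modular-zero []            = refl
  modular-zero (inside ∷ S)  = trans (+-identityˡ _) (modular-zero S)
  modular-zero (outside ∷ S) = modular-zero S

module _ {c ℓ₁ ℓ₂ : Level} (R : OrderedCommutativeRing c ℓ₁ ℓ₂) where
  open OrderedCommutativeRing R hiding (zero)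
  open IsTotalOrder isTotalOrder using (isPartialOrder)
    renaming (refl to ≤-refl; trans to ≤-trans)
  open RingProperties ring using (-0#≈0#; //-rightDividesˡ; -‿+-comm; x[y-z]≈xy-xz)
  open CommutativeSemigroupProperties +-commutativeSemigroup using (interchange)
  open Modular commutativeSemiring

  poset : Poset c ℓ₁ ℓ₂
  poset = record { isPartialOrder = isPartialOrder }

  open PosetReasoning poset

  +-monoʳ-≤ : ∀ x {y z} → y ≤ z → x + y ≤ x + z
  +-monoʳ-≤ x {y} {z} y≤z = begin
    x + y  ≈⟨ +-comm x y ⟩
    y + x  ≤⟨ +-monoˡ-≤ x y≤z ⟩
    z + x  ≈⟨ +-comm z x ⟩
    x + z  ∎

  +-mono-≤ : ∀ {w x y z} → w ≤ x → y ≤ z → w + y ≤ x + z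
  +-mono-≤ {x = x} {y} w≤x y≤z = ≤-trans (+-monoˡ-≤ y w≤x) (+-monoʳ-≤ x y≤z)

  x+[y-x]≈y : ∀ x y → x + (y - x) ≈ y
  x+[y-x]≈y x y = trans (+-comm x (y - x)) (//-rightDividesˡ x y)

  [x+z]-[y+z]≈x-y : ∀ x y z → (x + z) - (y + z) ≈ x - y
  [x+z]-[y+z]≈x-y x y z = begin-equality
    (x + z) - (y + z)        ≈⟨ +-congˡ (-‿+-comm y z) ⟨
    (x + z) + (- y + - z)    ≈⟨ interchange x z (- y) (- z) ⟩
    (x - y) + (z - z)        ≈⟨ +-congˡ (-‿inverseʳ z) ⟩
    (x - y) + 0#             ≈⟨ +-identityʳ (x - y) ⟩
    x - y                    ∎

  x-0≈x : ∀ x → x - 0# ≈ x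
  x-0≈x x = trans (+-congˡ -0#≈0#) (+-identityʳ x)

  x-[ty+sz]≈t[x-y]+s[x-z] : ∀ {t s} → t + s ≈ 1# → ∀ x y z →
    x - (t * y + s * z) ≈ t * (x - y) + s * (x - z)
  x-[ty+sz]≈t[x-y]+s[x-z] {t} {s} t+s≈1 x y z = begin-equality
    x - (t * y + s * z)                  ≈⟨ +-congʳ (trans (*-congʳ t+s≈1) (*-identityˡ x)) ⟨
    (t + s) * x - (t * y + s * z)        ≈⟨ +-cong (distribʳ x t s) (sym (-‿+-comm _ _)) ⟩
    (t * x + s * x) + (- (t * y) + - (s * z)) ≈⟨ interchange _ _ _ _ ⟩
    (t * x - t * y) + (s * x - s * z)    ≈⟨ +-cong (x[y-z]≈xy-xz t x y) (x[y-z]≈xy-xz s x z) ⟨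
    t * (x - y) + s * (x - z)            ∎

  x≤y⇒0≤y-x : ∀ {x y} → x ≤ y → 0# ≤ y - x
  x≤y⇒0≤y-x {x} {y} x≤y = begin
    0#     ≈⟨ -‿inverseʳ x ⟨
    x - x  ≤⟨ +-monoˡ-≤ (- x) x≤y ⟩
    y - x  ∎

  *-monoˡ-≤-nonNeg : ∀ {x y z} → 0# ≤ x → y ≤ z → x * y ≤ x * z
  *-monoˡ-≤-nonNeg {x} {y} {z} 0≤x y≤z = begin
    x * y                ≈⟨ +-identityʳ (x * y) ⟨
    x * y + 0#           ≤⟨ +-monoʳ-≤ (x * y) (*-nonneg 0≤x (x≤y⇒0≤y-x y≤z)) ⟩
    x * y + x * (z - y)  ≈⟨ distribˡ x y (z - y) ⟨
    x * (y + (z - y))    ≈⟨ *-congˡ (x+[y-x]≈y y z) ⟩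
    x * z                ∎

  x-y≤z⇒x≤y+z : ∀ {x y z} → x - y ≤ z → x ≤ y + z
  x-y≤z⇒x≤y+z {x} {y} {z} x-y≤z = begin
    x            ≈⟨ x+[y-x]≈y y x ⟨
    y + (x - y)  ≤⟨ +-monoʳ-≤ y x-y≤z ⟩
    y + z        ∎

  z≤x-y⇒y+z≤x : ∀ {x y z} → z ≤ x - y → y + z ≤ x
  z≤x-y⇒y+z≤x {x} {y} {z} z≤x-y = begin
    y + z        ≤⟨ +-monoʳ-≤ y z≤x-y ⟩
    y + (x - y)  ≈⟨ x+[y-x]≈y y x ⟩
    x            ∎

  x+w≤z+y⇒x-y≤z-w : ∀ {w x y z} → x + w ≤ z + y → x - y ≤ z - w
  x+w≤z+y⇒x-y≤z-w {w} {x} {y} {z} x+w≤z+y = begin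
    x - y              ≈⟨ [x+z]-[y+z]≈x-y x y w ⟨
    (x + w) - (y + w)  ≤⟨ +-monoˡ-≤ (- (y + w)) x+w≤z+y ⟩
    (z + y) - (y + w)  ≈⟨ +-congˡ (-‿cong (+-comm y w)) ⟩
    (z + y) - (w + y)  ≈⟨ [x+z]-[y+z]≈x-y z w y ⟩
    z - w              ∎

  module _ {n : ℕ} where

    infixl 6 _⊖_
    _⊖_ : (Subset n → Carrier) → (Fin n → Carrier) → Subset n → Carrier
    (f ⊖ x) S = f S - modular x S

    IsSupergradient : (Subset n → Carrier) → Subset n → (Fin n → Carrier) → Set ℓ₂
    IsSupergradient f A x = ∀ X → (f ⊖ x) X ≤ (f ⊖ x) A

    module _ (f : Subset n → Carrier) where

      marginal-antitone : Submodular R f → ∀ {Z W k} → Z ⊆ W → k ∉ W →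
                          marginal R f k W ≤ marginal R f k Z
      marginal-antitone submodular {Z} {W} {k} Z⊆W k∉W =
        x+w≤z+y⇒x-y≤z-w
          (≡.subst₂ (λ U V → f U + f V ≤ f (Z ∪ ⁅ k ⁆) + f W)
            (p⊆q⇒[p∪⁅x⁆]∪q≡q∪⁅x⁆ k Z⊆W) (p⊆q∧x∉q⇒[p∪⁅x⁆]∩q≡p Z⊆W k∉W)
            (submodular (Z ∪ ⁅ k ⁆) W))

      marginal-⊥ : f ⊥ ≈ 0# → ∀ k → marginal R f k ⊥ ≈ f ⁅ k ⁆
      marginal-⊥ f⊥≈0 k = begin-equality
        f (⊥ ∪ ⁅ k ⁆) - f ⊥  ≡⟨ cong (λ S → f S - f ⊥) (∪-identityˡ ⁅ k ⁆) ⟩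
        f ⁅ k ⁆ - f ⊥        ≈⟨ +-congˡ (-‿cong f⊥≈0) ⟩
        f ⁅ k ⁆ - 0#         ≈⟨ x-0≈x (f ⁅ k ⁆) ⟩
        f ⁅ k ⁆              ∎

      ⊖-∪⁅⁆-≤ : ∀ x {Z k} → k ∉ Z → marginal R f k Z ≤ x k →
                (f ⊖ x) (Z ∪ ⁅ k ⁆) ≤ (f ⊖ x) Z
      ⊖-∪⁅⁆-≤ x {Z} {k} k∉Z gain≤x = begin
        f (Z ∪ ⁅ k ⁆) - modular x (Z ∪ ⁅ k ⁆)   ≈⟨ +-congˡ (-‿cong (modular-∪⁅⁆ x k∉Z)) ⟩
        f (Z ∪ ⁅ k ⁆) - (modular x Z + x k)     ≤⟨ +-monoˡ-≤ _ (x-y≤z⇒x≤y+z gain≤x) ⟩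
        (f Z + x k) - (modular x Z + x k)       ≈⟨ [x+z]-[y+z]≈x-y _ _ _ ⟩
        f Z - modular x Z                       ∎

      ⊖-∪⁅⁆-≥ : ∀ x {Z k} → k ∉ Z → x k ≤ marginal R f k Z →
                (f ⊖ x) Z ≤ (f ⊖ x) (Z ∪ ⁅ k ⁆)
      ⊖-∪⁅⁆-≥ x {Z} {k} k∉Z x≤gain = begin
        f Z - modular x Z                       ≈⟨ [x+z]-[y+z]≈x-y _ _ _ ⟨
        (f Z + x k) - (modular x Z + x k)       ≤⟨ +-monoˡ-≤ _ (z≤x-y⇒y+z≤x x≤gain) ⟩
        f (Z ∪ ⁅ k ⁆) - (modular x Z + x k)     ≈⟨ +-congˡ (-‿cong (modular-∪⁅⁆ x k∉Z)) ⟨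
        f (Z ∪ ⁅ k ⁆) - modular x (Z ∪ ⁅ k ⁆)   ∎

      telescope-≤ : ∀ x S D → Stepwise _≤_ (f ⊖ x) S D → (f ⊖ x) (S ∪ D) ≤ (f ⊖ x) S
      telescope-≤ x = telescope _≤_ ≤-refl ≤-trans (f ⊖ x)

      telescope-≥ : ∀ x S D → Stepwise (flip _≤_) (f ⊖ x) S D → (f ⊖ x) S ≤ (f ⊖ x) (S ∪ D)
      telescope-≥ x = telescope (flip _≤_) ≤-refl (flip ≤-trans) (f ⊖ x)

      ∂₁⇒isSupergradient : Submodular R f → f ⊥ ≈ 0# → ∀ {A x} → ∂₁ R f A x →
                           IsSupergradient f A x
      ∂₁⇒isSupergradient submodular f⊥≈0 {A} {x} (x≤gain , f⁅⁆≤x) X = begin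
        (f ⊖ x) X              ≡⟨ cong (f ⊖ x) (p⊆q⇒p∪q≡q (p∩q⊆q A X)) ⟨
        (f ⊖ x) (A ∩ X ∪ X)    ≤⟨ telescope-≤ x (A ∩ X) X up ⟩
        (f ⊖ x) (A ∩ X)        ≤⟨ telescope-≥ x (A ∩ X) A down ⟩
        (f ⊖ x) (A ∩ X ∪ A)    ≡⟨ cong (f ⊖ x) (p⊆q⇒p∪q≡q (p∩q⊆p A X)) ⟩
        (f ⊖ x) A              ∎
        where
        up : Stepwise _≤_ (f ⊖ x) (A ∩ X) X
        up {Z} {k} k∈X k∉Z A∩X⊆Z _ = ⊖-∪⁅⁆-≤ x k∉Z (begin
          marginal R f k Z  ≤⟨ marginal-antitone submodular ⊥⊆ k∉Z ⟩
          marginal R f k ⊥  ≈⟨ marginal-⊥ f⊥≈0 k ⟩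
          f ⁅ k ⁆           ≤⟨ f⁅⁆≤x k (λ k∈A → k∉Z (A∩X⊆Z (x∈p∩q⁺ (k∈A , k∈X)))) ⟩
          x k               ∎)
        down : Stepwise (flip _≤_) (f ⊖ x) (A ∩ X) A
        down {Z} {k} k∈A k∉Z _ Z⊆A∩X∪A = ⊖-∪⁅⁆-≥ x k∉Z
          (≤-trans (x≤gain k k∈A) (marginal-antitone submodular Z⊆A∖k (x∉p∖x A k)))
          where
          Z⊆A∖k : Z ⊆ A ∖ k
          Z⊆A∖k = p⊆q∧x∉p⇒p⊆q∖x
            (⊆-trans Z⊆A∩X∪A (⊆-reflexive (p⊆q⇒p∪q≡q (p∩q⊆p A X)))) k∉Z

      ∂₂⇒isSupergradient : Submodular R f → ∀ {A x} → ∂₂ R f A x → IsSupergradient f A x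
      ∂₂⇒isSupergradient submodular {A} {x} (x≤gain , gain≤x) X = begin
        (f ⊖ x) X          ≤⟨ telescope-≥ x X A down ⟩
        (f ⊖ x) (X ∪ A)    ≡⟨ cong (f ⊖ x) (∪-comm X A) ⟩
        (f ⊖ x) (A ∪ X)    ≤⟨ telescope-≤ x A X up ⟩
        (f ⊖ x) A          ∎
        where
        up : Stepwise _≤_ (f ⊖ x) A X
        up {Z} {k} _ k∉Z A⊆Z _ = ⊖-∪⁅⁆-≤ x k∉Z
          (≤-trans (marginal-antitone submodular A⊆Z k∉Z) (gain≤x k (k∉Z ∘ A⊆Z)))
        down : Stepwise (flip _≤_) (f ⊖ x) X A
        down {Z} {k} k∈A k∉Z _ _ = ⊖-∪⁅⁆-≥ x k∉Z
          (≤-trans (x≤gain k k∈A)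
            (marginal-antitone submodular (p⊆q∧x∉p⇒p⊆q∖x ⊆⊤ k∉Z) (x∉p∖x ⊤ k)))

      isSupergradient-convex : ∀ {A t x₁ x₂ x} → 0# ≤ t → t ≤ 1# →
        IsSupergradient f A x₁ → IsSupergradient f A x₂ →
        (∀ j → x j ≈ t * x₁ j + (1# - t) * x₂ j) → IsSupergradient f A x
      isSupergradient-convex {A} {t} {x₁} {x₂} {x} 0≤t t≤1 sg₁ sg₂ x≈ X = begin
        (f ⊖ x) X                                  ≈⟨ ⊖-affine X ⟩
        t * (f ⊖ x₁) X + (1# - t) * (f ⊖ x₂) X     ≤⟨ +-mono-≤ (*-monoˡ-≤-nonNeg 0≤t (sg₁ X))
                                                        (*-monoˡ-≤-nonNeg (x≤y⇒0≤y-x t≤1) (sg₂ X)) ⟩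
        t * (f ⊖ x₁) A + (1# - t) * (f ⊖ x₂) A     ≈⟨ ⊖-affine A ⟨
        (f ⊖ x) A                                  ∎
        where
        ⊖-affine : ∀ S → (f ⊖ x) S ≈ t * (f ⊖ x₁) S + (1# - t) * (f ⊖ x₂) S
        ⊖-affine S = trans
          (+-congˡ (-‿cong (trans (modular-cong x≈ S) (modular-linear t (1# - t) x₁ x₂ S))))
          (x-[ty+sz]≈t[x-y]+s[x-z] (x+[y-x]≈y t 1#) (f S) _ _)

      zero-isSupergradient⇒maximum : ∀ {A} → IsSupergradient f A (λ _ → 0#) → ∀ X → f X ≤ f A
      zero-isSupergradient⇒maximum {A} 0∈∂f X = begin
        f X                  ≈⟨ ⊖-zero X ⟨
        (f ⊖ (λ _ → 0#)) X   ≤⟨ 0∈∂f X ⟩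
        (f ⊖ (λ _ → 0#)) A   ≈⟨ ⊖-zero A ⟩
        f A                  ∎
        where
        ⊖-zero : ∀ S → (f ⊖ (λ _ → 0#)) S ≈ f S
        ⊖-zero S = trans (+-congˡ (-‿cong (modular-zero S))) (x-0≈x (f S))

lemma14 : {c ℓ₁ ℓ₂ : Level} (R : OrderedCommutativeRing c ℓ₁ ℓ₂) (n : ℕ)
    (f : Subset n → OrderedCommutativeRing.Carrier R) →
    Submodular R f →
    OrderedCommutativeRing._≈_ R (f ⊥) (OrderedCommutativeRing.0# R) →
    (A : Subset n) →
    ∂₁₂ R f A (λ _ → OrderedCommutativeRing.0# R) →
    (X : Subset n) → OrderedCommutativeRing._≤_ R (f X) (f A)
lemma14 R n f submodular f⊥≈0 A (t , x₁ , x₂ , 0≤t , t≤1 , x₁∈∂₁ , x₂∈∂₂ , 0≈) =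
  zero-isSupergradient⇒maximum R f
    (isSupergradient-convex R f 0≤t t≤1
      (∂₁⇒isSupergradient R f submodular f⊥≈0 x₁∈∂₁)
      (∂₂⇒isSupergradient R f submodular x₂∈∂₂)
      0≈)
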